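{- Let $G=(V,E)$ be a connected simple graph. For each edge $e=uv\in E$ let $V_{<,e}=\{w\in V : d(u,w)<d(v,w)\}$ and $V_{>,e}=\{w\in V : d(u,w)>d(v,w)\}$. Let $MHSP(\{V_{<,e},V_{>,e}\mid e\in E\})$ denote the minimum cardinality of a set $H\subseteq V$ such that $H\cap V_{<,e}\neq\emptyset$ and $H\cap V_{>,e}\neq\emptyset$ for every $e\in E$. Then $\beta_M(G)\geq MHSP(\{V_{<,e},V_{>,e}\mid e\in E\})$.
   Context: For vertices $u,v$, $d(u,v)$ is the number of edges on a shortest $u$–$v$ path. For a vertex $w$ and an edge $e=uv$, $d(w,e)=\min(d(w,u),d(w,v))$. A vertex $w$ resolves two elements $x,y\in V\cup E$ if $d(w,x)\neq d(w,y)$. A set $S\subseteq V$ is a mixed resolving set if every pair of distinct elements of $V\cup E$ is resolved by some element of $S$. The mixed metric dimension $\beta_M(G)$ is the minimum cardinality of a mixed resolving set of $G$. (For an edge $e=uv$, swapping the roles of $u$ and $v$ only swaps $V_{<,e}$ and $V_{>,e}$, so the family is well defined.) -}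

module Defs where

open import Data.Nat using (ℕ; zero; suc; _<_; _≤_; _⊓_)
open import Data.Fin using (Fin)
open import Data.Fin.Subset using (Subset; _∈_; ∣_∣)
open import Data.Product using (Σ; ∃; ∃-syntax; _×_; _,_)
open import Data.Sum using (_⊎_)
open import Data.Empty using (⊥)
open import Relation.Nullary using (¬_)
open import Relation.Binary.PropositionalEquality using (_≡_; _≢_)

record Graph (n : ℕ) : Set₁ where
  field
    Adj     : Fin n → Fin n → Set
    sym     : ∀ {u v} → Adj u v → Adj v u
    irrefl  : ∀ {u} → ¬ Adj u u

module _ {n : ℕ} (G : Graph n) where
  open Graph G

  data Walk : Fin n → Fin n → ℕ → Set where
    nil  : ∀ {u} → Walk u u zero
    cons : ∀ {u v w k} → Adj u v → Walk v w k → Walk u w (suc k)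

  Connected : Set
  Connected = ∀ u v → ∃[ k ] Walk u v k

  IsDist : Fin n → Fin n → ℕ → Set
  IsDist u v k = Walk u v k × (∀ m → m < k → ¬ Walk u v m)

  -- Elements of V ∪ E.  An edge uv is given by an adjacent ordered pair;
  -- the pairs (u,v) and (v,u) denote the same edge (see SameElem).
  data Elem : Set where
    vert : Fin n → Elem
    edge : (u v : Fin n) → Adj u v → Elem

  SameElem : Elem → Elem → Set
  SameElem (vert u) (vert v) = u ≡ v
  SameElem (vert _) (edge _ _ _) = ⊥
  SameElem (edge _ _ _) (vert _) = ⊥
  SameElem (edge u v _) (edge u' v' _) = (u ≡ u' × v ≡ v') ⊎ (u ≡ v' × v ≡ u')

  DistE : Fin n → Elem → ℕ → Set
  DistE w (vert u) k = IsDist w u k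
  DistE w (edge u v _) k = ∃[ a ] ∃[ b ] (IsDist w u a × IsDist w v b × k ≡ a ⊓ b)

  Resolves : Fin n → Elem → Elem → Set
  Resolves w x y = ∀ a b → DistE w x a → DistE w y b → a ≢ b

  MixedResolving : Subset n → Set
  MixedResolving S = ∀ x y → ¬ SameElem x y → ∃[ w ] (w ∈ S × Resolves w x y)

  InVLess : Fin n → Fin n → Fin n → Set
  InVLess u v w = ∃[ a ] ∃[ b ] (IsDist u w a × IsDist v w b × a < b)

  InVGreater : Fin n → Fin n → Fin n → Set
  InVGreater u v w = ∃[ a ] ∃[ b ] (IsDist u w a × IsDist v w b × b < a)

  HitsAll : Subset n → Set
  HitsAll H = ∀ u v → Adj u v →
    (∃[ w ] (w ∈ H × InVLess u v w)) × (∃[ w ] (w ∈ H × InVGreater u v w))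

IsMinCard : {n : ℕ} → (Subset n → Set) → ℕ → Set
IsMinCard {n} P k = (∃[ S ] (P S × ∣ S ∣ ≡ k)) × (∀ S → P S → k ≤ ∣ S ∣)

-- Let S be a mixed resolving set and e = uv an edge.  Some
-- w ∈ S resolves the vertex v from the edge e, i.e. d(w,v) ≠ min(d(w,u), d(w,v)),
-- which forces d(w,u) < d(w,v): w ∈ V_{<,e}.  Symmetrically, a w' ∈ S resolving
-- u from e lies in V_{>,e}.  So S is a hitting set for the family, and
-- MHSP ≤ |S| = β_M.
--
-- Adjacency is an arbitrary relation, so distances
-- (least walk lengths) exist only classically.  The conclusion MHSP ≤ β_M is a
-- decidable statement about naturals, hence stable under double negation, so
-- the whole argument runs in the double-negation monad.
module Submission where

open import Defs
open import Data.Nat using (ℕ; zero; suc; _≤_; _<_; _⊓_)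
open import Data.Nat.Properties
  using (_≤?_; ≤-refl; ≰⇒>; m≤n⇒m⊓n≡m; m≥n⇒m⊓n≡n; m<1+n⇒m<n∨m≡n)
open import Data.Fin using (Fin)
import Data.Fin as Fin
open import Data.Fin.Subset using (_∈_; ∣_∣)
open import Data.Product using (∃-syntax; _×_; _,_)
open import Data.Sum using (_⊎_; inj₁; inj₂; [_,_])
open import Data.Empty using (⊥-elim)
open import Level using (0ℓ)
open import Effect.Monad using (RawMonad)
open import Relation.Nullary using (¬_; Dec; yes; no)
open import Relation.Nullary.Decidable using (decidable-stable; ¬¬-excluded-middle)
open import Relation.Nullary.Negation using (¬¬-Monad; ¬¬-map; contradiction)
open import Relation.Binary.PropositionalEquality using (_≢_; refl; sym; subst)

open RawMonad (¬¬-Monad {0ℓ}) using (pure; _>>=_)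

¬¬-∀-Fin : ∀ {n} {P : Fin n → Set} → (∀ i → ¬ ¬ P i) → ¬ ¬ (∀ i → P i)
¬¬-∀-Fin {zero}  h = pure λ ()
¬¬-∀-Fin {suc n} h = do
  p₀ ← h Fin.zero
  ps ← ¬¬-∀-Fin (λ i → h (Fin.suc i))
  pure λ { Fin.zero → p₀ ; (Fin.suc i) → ps i }

¬¬-→ : ∀ {A X : Set} → (A → ¬ ¬ X) → ¬ ¬ (A → X)
¬¬-→ {A} {X} f = ¬¬-excluded-middle >>= byCases
  where
  byCases : Dec A → ¬ ¬ (A → X)
  byCases (yes a) = ¬¬-map (λ x _ → x) (f a)
  byCases (no ¬a) = pure λ a → contradiction a ¬a

-- The least natural number satisfying P.  Note that ∃[ k ] IsDist G u v k
-- unfolds to Least (Walk G u v): a distance is a least walk length.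
Least : (ℕ → Set) → Set
Least P = ∃[ m ] (P m × (∀ j → j < m → ¬ P j))

least-or-none-below : (P : ℕ → Set) (N : ℕ) →
  ¬ ¬ (Least P ⊎ (∀ j → j < N → ¬ P j))
least-or-none-below P zero    = pure (inj₂ λ _ ())
least-or-none-below P (suc N) = least-or-none-below P N >>= extend
  where
  extend : Least P ⊎ (∀ j → j < N → ¬ P j) →
           ¬ ¬ (Least P ⊎ (∀ j → j < suc N → ¬ P j))
  extend (inj₁ least) = pure (inj₁ least)
  extend (inj₂ none)  = ¬¬-map decideN ¬¬-excluded-middle
    where
    decideN : Dec (P N) → Least P ⊎ (∀ j → j < suc N → ¬ P j)
    decideN (yes pN) = inj₁ (N , pN , none)
    decideN (no ¬pN) = inj₂ λ j j<1+N →
      [ none j , (λ { refl → ¬pN }) ] (m<1+n⇒m<n∨m≡n j<1+N)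

¬¬-least : ∀ (P : ℕ → Set) {k} → P k → ¬ ¬ Least P
¬¬-least P {k} pk = ¬¬-map resolve (least-or-none-below P (suc k))
  where
  resolve : Least P ⊎ (∀ j → j < suc k → ¬ P j) → Least P
  resolve (inj₁ least) = least
  resolve (inj₂ none)  = ⊥-elim (none k ≤-refl pk)

⊓≢ʳ⇒< : ∀ a b → b ≢ a ⊓ b → a < b
⊓≢ʳ⇒< a b ne = ≰⇒> λ b≤a → ne (sym (m≥n⇒m⊓n≡n b≤a))

⊓≢ˡ⇒> : ∀ a b → a ≢ a ⊓ b → b < a
⊓≢ˡ⇒> a b ne = ≰⇒> λ a≤b → ne (sym (m≤n⇒m⊓n≡m a≤b))

module _ {n : ℕ} (G : Graph n) where
  open Graph G using (Adj)

  snoc : ∀ {u v w k} → Walk G u v k → Adj v w → Walk G u w (suc k)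
  snoc nil          a = cons a nil
  snoc (cons a′ p)  a = cons a′ (snoc p a)

  reverse : ∀ {u v k} → Walk G u v k → Walk G v u k
  reverse nil        = nil
  reverse (cons a p) = snoc (reverse p) (Graph.sym G a)

  IsDist-sym : ∀ {u v k} → IsDist G u v k → IsDist G v u k
  IsDist-sym (p , shortest) = reverse p , λ m m<k q → shortest m m<k (reverse q)

  ¬¬-dist : Connected G → ∀ u v → ¬ ¬ (∃[ k ] IsDist G u v k)
  ¬¬-dist connected u v with connected u v
  ... | _ , walk = ¬¬-least (Walk G u v) walk

  resolves-head⇒VLess : ∀ {u v w a b} (e : Adj u v) →
    IsDist G w u a → IsDist G w v b →
    Resolves G w (vert v) (edge u v e) → InVLess G u v w
  resolves-head⇒VLess {a = a} {b} e du dv r =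
    a , b , IsDist-sym du , IsDist-sym dv ,
    ⊓≢ʳ⇒< a b (r b (a ⊓ b) dv (a , b , du , dv , refl))

  resolves-tail⇒VGreater : ∀ {u v w a b} (e : Adj u v) →
    IsDist G w u a → IsDist G w v b →
    Resolves G w (vert u) (edge u v e) → InVGreater G u v w
  resolves-tail⇒VGreater {a = a} {b} e du dv r =
    a , b , IsDist-sym du , IsDist-sym dv ,
    ⊓≢ˡ⇒> a b (r a (a ⊓ b) du (a , b , du , dv , refl))

  resolving-hits-edge : Connected G → ∀ S → MixedResolving G S →
    ∀ u v (e : Adj u v) →
    ¬ ¬ ((∃[ w ] (w ∈ S × InVLess G u v w)) × (∃[ w ] (w ∈ S × InVGreater G u v w)))
  resolving-hits-edge connected S resolving u v e
    with resolving (vert v) (edge u v e) (λ ()) | resolving (vert u) (edge u v e) (λ ())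
  ... | w , w∈S , r | w′ , w′∈S , r′ = do
    (_ , dwu)   ← ¬¬-dist connected w u
    (_ , dwv)   ← ¬¬-dist connected w v
    (_ , dw′u)  ← ¬¬-dist connected w′ u
    (_ , dw′v)  ← ¬¬-dist connected w′ v
    pure ( (w  , w∈S  , resolves-head⇒VLess e dwu dwv r)
         , (w′ , w′∈S , resolves-tail⇒VGreater e dw′u dw′v r′))

  resolving⇒hitting : Connected G → ∀ S → MixedResolving G S → ¬ ¬ HitsAll G S
  resolving⇒hitting connected S resolving =
    ¬¬-∀-Fin λ u → ¬¬-∀-Fin λ v → ¬¬-→ (resolving-hits-edge connected S resolving u v)

theorem3 : (n : ℕ) (G : Graph n) → Connected G →
    (βM mhsp : ℕ) →
    IsMinCard (MixedResolving G) βM →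
    IsMinCard (HitsAll G) mhsp →
    mhsp ≤ βM
theorem3 n G connected βM mhsp ((S , resolving , ∣S∣≡βM) , _) (_ , mhsp-minimal) =
  subst (mhsp ≤_) ∣S∣≡βM
    (decidable-stable (mhsp ≤? ∣ S ∣)
      (¬¬-map (mhsp-minimal S) (resolving⇒hitting G connected S resolving)))
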